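{- Let $A$ be a finite multiset of nonempty strings over a totally ordered alphabet, and let $B$ be the associated set (the multiset $A$ with all duplicates removed). Then $\rho(A)=\rho(B)$.
   Context: For a string $x=x_1\cdots x_n$, $\texttt{runs}(x)=\sum_{i=1}^{n-1}\mathbf{1}_{x_i\neq x_{i+1}}$. Every string $u$ can be written uniquely as $u=v^e$ with $v$ primitive; write $\mathrm{root}(u)=v$, $\exp(u)=e$. The $\omega$-order: $u\preceq_\omega v$ iff either $\mathrm{root}(u)=\mathrm{root}(v)$ and $\exp(u)\leq\exp(v)$, or $\mathrm{root}(u)\neq\mathrm{root}(v)$ and $u^\omega<_{\mathrm{lex}}v^\omega$. For a multiset $W$ of nonempty strings, $\texttt{ebwt}(W)$ is obtained by listing all circular rotations of all strings of $W$ (one per position of each string, with multiplicity), sorting them in ascending $\omega$-order, and concatenating their last characters. $\rho(W)=\texttt{runs}(\texttt{ebwt}(W))$. -}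

module Defs where

open import Level using (Level; _⊔_)
open import Data.Nat using (ℕ; zero; suc; _≤_; _<_)
open import Data.Product using (Σ; _×_; _,_; ∃)
open import Data.Sum using (_⊎_)
open import Data.List using (List; []; _∷_; _++_; concatMap; iterate; length; map)
open import Data.List.NonEmpty using (List⁺; _∷_; toList; head; tail; last; _∷ʳ_)
open import Data.List.Relation.Unary.Linked using (Linked)
open import Data.List.Relation.Binary.Permutation.Propositional using (_↭_)
open import Relation.Binary.Core using (Rel)
open import Relation.Binary.Definitions using (DecidableEquality)
open import Relation.Binary.PropositionalEquality using (_≡_; _≢_)
open import Relation.Nullary using (yes; no)

runs : ∀ {a} {A : Set a} → DecidableEquality A → List A → ℕ
runs _≟_ [] = 0
runs _≟_ (x ∷ xs) = go x xs
  where
  go : _ → List _ → ℕ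
  go x [] = 0
  go x (y ∷ ys) with x ≟ y
  ... | yes _ = go y ys
  ... | no  _ = suc (go y ys)

pow : ∀ {a} {A : Set a} → List A → ℕ → List A
pow v zero = []
pow v (suc e) = v ++ pow v e

module _ {a ℓ} {A : Set a} (_<ₐ_ : Rel A ℓ) where

  Primitive : List⁺ A → Set a
  Primitive v = ∀ (w : List A) (e : ℕ) → toList v ≡ pow w e → e ≡ 1

  IsRoot : List⁺ A → List⁺ A → ℕ → Set a
  IsRoot u v e = Primitive v × (toList u ≡ pow (toList v) e)

  -- the infinite string u^ω as a function ℕ → A
  ωAux : A → List A → List⁺ A → ℕ → A
  ωAux x xs w zero = x
  ωAux x [] w (suc i) = ωAux (head w) (tail w) w i
  ωAux x (y ∷ ys) w (suc i) = ωAux y ys w i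

  ωstr : List⁺ A → ℕ → A
  ωstr w = ωAux (head w) (tail w) w

  Lex< : (ℕ → A) → (ℕ → A) → Set (a ⊔ ℓ)
  Lex< s t = ∃ λ k → (∀ i → i < k → s i ≡ t i) × (s k <ₐ t k)

  _⪯ω_ : List⁺ A → List⁺ A → Set (a ⊔ ℓ)
  u ⪯ω v =
    (Σ (List⁺ A) λ r → Σ ℕ λ e → Σ ℕ λ f → IsRoot u r e × IsRoot v r f × e ≤ f)
    ⊎ ((∀ r s e f → IsRoot u r e → IsRoot v s f → r ≢ s) × Lex< (ωstr u) (ωstr v))

  rot : List⁺ A → List⁺ A
  rot (x ∷ xs) = xs ∷ʳ x

  rotations : List⁺ A → List (List⁺ A)
  rotations w = iterate rot w (length (toList w))

  allRotations : List (List⁺ A) → List (List⁺ A)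
  allRotations W = concatMap rotations W

  IsEbwt : List (List⁺ A) → List A → Set (a ⊔ ℓ)
  IsEbwt W b = Σ (List (List⁺ A)) λ L →
    (L ↭ allRotations W) × Linked _⪯ω_ L × (b ≡ map last L)

-- Sorting the rotations of A and of B gives two lists with the same elements that differ only
-- in how often each rotation is repeated.  Because the ω-order is antisymmetric, equal rotations
-- sit next to each other in a sorted list, so deleting adjacent duplicates (derun) turns both
-- lists into strictly sorted lists with the same elements, which must then be identical.
-- Deleting an adjacent duplicate rotation deletes an adjacent repeated last letter, which does
-- not change the number of runs.

module Submission where

open import Defs
open import Data.List using (List)
open import Data.List.NonEmpty using (List⁺)
open import Data.List.Relation.Unary.Unique.Propositional using (Unique)
open import Data.List.Membership.Propositional using (_∈_)
open import Function.Bundles using (_⇔_)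
open import Relation.Binary.Core using (Rel)
open import Relation.Binary.Structures using (IsStrictTotalOrder)
open import Relation.Binary.PropositionalEquality using (_≡_)

open import Data.Empty using (⊥-elim)
open import Level using (_⊔_)
open import Data.Nat using (ℕ; zero; suc; _+_; _*_; _≤_)
  renaming (_<_ to _<ℕ_)
open import Data.Nat.Properties using (<-cmp; <-trans; ≤-refl; ≤-trans; ≤-antisym; *-monoˡ-≤; suc-injective; m<n⇒m<1+n)
open import Data.Nat.Induction using (<-rec)
open import Data.Product using (_×_; _,_; ∃)
open import Data.Sum using (_⊎_; inj₁; inj₂)
open import Data.List using ([]; _∷_; _++_; length; map; derun)
open import Data.List.Properties using (length-++; ≡-dec)
open import Data.List.NonEmpty using (_∷_; toList; last)
open import Data.List.Membership.Propositional.Properties using (∈-derun⁺; ∈-derun⁻)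
open import Data.List.Relation.Unary.All as All using (All)
open import Data.List.Relation.Unary.AllPairs using (AllPairs; []; _∷_)
open import Data.List.Relation.Unary.Any using (here; there)
open import Data.List.Relation.Unary.Linked as Linked using (Linked; []; [-]; _∷_)
open import Data.List.Relation.Unary.Linked.Properties using (Linked⇒AllPairs)
open import Data.List.Relation.Binary.Permutation.Propositional using (_↭_)
open import Data.List.Relation.Binary.BagAndSetEquality
  using (_∼[_]_; set; bag-=⇒; ↭⇒∼bag; concat-cong; map-cong)
open import Function using (_∘_)
open import Function.Bundles using (Equivalence; mk⇔)
import Function.Properties.Equivalence as ⇔
open import Relation.Binary.Definitions using (Asymmetric; DecidableEquality; tri<; tri≈; tri>)
open import Relation.Binary.Structures using (IsPartialOrder; IsStrictPartialOrder)
open import Relation.Binary.PropositionalEquality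
  using (refl; sym; trans; cong; cong₂; subst; subst₂; _≗_; isEquivalence; module ≡-Reasoning)
import Relation.Binary.Construct.NonStrictToStrict as NonStrictToStrict
open import Relation.Nullary using (¬_; yes; no; contradiction)
open import Relation.Nullary.Decidable using (map′)

module _ {a} {X : Set a} where

  infixr 5 _++ω_

  _++ω_ : List X → (ℕ → X) → (ℕ → X)
  ([] ++ω s) i = s i
  ((x ∷ p) ++ω s) zero = x
  ((x ∷ p) ++ω s) (suc i) = (p ++ω s) i

  ++ω-assoc : ∀ p q (s : ℕ → X) → (p ++ q) ++ω s ≗ p ++ω (q ++ω s)
  ++ω-assoc [] q s i = refl
  ++ω-assoc (x ∷ p) q s zero = refl
  ++ω-assoc (x ∷ p) q s (suc i) = ++ω-assoc p q s i

  ++ω-congʳ : ∀ p {s t : ℕ → X} → s ≗ t → p ++ω s ≗ p ++ω t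
  ++ω-congʳ [] s≗t i = s≗t i
  ++ω-congʳ (x ∷ p) s≗t zero = refl
  ++ω-congʳ (x ∷ p) s≗t (suc i) = ++ω-congʳ p s≗t i

  ++ω-pow : ∀ p {s : ℕ → X} → s ≗ p ++ω s → ∀ e → s ≗ pow p e ++ω s
  ++ω-pow p s≗ps zero i = refl
  ++ω-pow p {s} s≗ps (suc e) i = begin
    s i                          ≡⟨ s≗ps i ⟩
    (p ++ω s) i                  ≡⟨ ++ω-congʳ p (++ω-pow p s≗ps e) i ⟩
    (p ++ω pow p e ++ω s) i      ≡⟨ ++ω-assoc p (pow p e) s i ⟨
    ((p ++ pow p e) ++ω s) i     ∎
    where open ≡-Reasoning

  ++ω-cong-below : ∀ x p {s t : ℕ → X} i → (∀ {j} → j <ℕ i → s j ≡ t j) →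
                   ((x ∷ p) ++ω s) i ≡ ((x ∷ p) ++ω t) i
  ++ω-cong-below x p zero s≡t = refl
  ++ω-cong-below x [] (suc i) s≡t = s≡t ≤-refl
  ++ω-cong-below x (y ∷ p) (suc i) s≡t =
    ++ω-cong-below y p i (s≡t ∘ m<n⇒m<1+n)

  ++ω-fixpoint-unique : ∀ x p {s t : ℕ → X} →
                        s ≗ (x ∷ p) ++ω s → t ≗ (x ∷ p) ++ω t → s ≗ t
  ++ω-fixpoint-unique x p {s} {t} s-fix t-fix = <-rec (λ i → s i ≡ t i) step
    where
    step : ∀ i → (∀ {j} → j <ℕ i → s j ≡ t j) → s i ≡ t i
    step i s≡t = trans (s-fix i) (trans (++ω-cong-below x p i s≡t) (sym (t-fix i)))

  ++ω-injectiveˡ : ∀ p q {s t : ℕ → X} → length p ≡ length q → p ++ω s ≗ q ++ω t → p ≡ q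
  ++ω-injectiveˡ [] [] _ _ = refl
  ++ω-injectiveˡ (x ∷ p) (y ∷ q) |p|≡|q| ps≗qt =
    cong₂ _∷_ (ps≗qt zero) (++ω-injectiveˡ p q (suc-injective |p|≡|q|) (ps≗qt ∘ suc))

  length-pow : ∀ (p : List X) e → length (pow p e) ≡ e * length p
  length-pow p zero = refl
  length-pow p (suc e) = trans (length-++ p) (cong (length p +_) (length-pow p e))

  toList-injective : ∀ {u v : List⁺ X} → toList u ≡ toList v → u ≡ v
  toList-injective {x ∷ xs} refl = refl

  ≡-dec⁺ : DecidableEquality X → DecidableEquality (List⁺ X)
  ≡-dec⁺ _≟_ u v = map′ toList-injective (cong toList) (≡-dec _≟_ (toList u) (toList v))

module _ {a ℓ} {X : Set a} (_<_ : Rel X ℓ) where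

  ωAux-unfold : ∀ x xs w → ωAux _<_ x xs w ≗ (x ∷ xs) ++ω ωstr _<_ w
  ωAux-unfold x xs w zero = refl
  ωAux-unfold x [] w (suc i) = refl
  ωAux-unfold x (y ∷ ys) w (suc i) = ωAux-unfold y ys w i

  ωstr-unfold : ∀ w → ωstr _<_ w ≗ toList w ++ω ωstr _<_ w
  ωstr-unfold (x ∷ xs) = ωAux-unfold x xs (x ∷ xs)

  ωstr-root : ∀ {u} r e → IsRoot _<_ u r e → ωstr _<_ u ≗ ωstr _<_ r
  ωstr-root {x ∷ xs} r e (_ , u≡rᵉ) =
    ++ω-fixpoint-unique x xs (ωstr-unfold (x ∷ xs)) r^ω-fix
    where
    r^ω-fix : ωstr _<_ r ≗ (x ∷ xs) ++ω ωstr _<_ r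
    r^ω-fix i = subst (λ p → ωstr _<_ r i ≡ (p ++ω ωstr _<_ r) i) (sym u≡rᵉ)
                  (++ω-pow (toList r) (ωstr-unfold r) e i)

  length-root : ∀ {u} r e → IsRoot _<_ u r e → length (toList u) ≡ e * length (toList r)
  length-root r e (_ , u≡rᵉ) = trans (cong length u≡rᵉ) (length-pow (toList r) e)

module _ {a ℓ} {X : Set a} {_<_ : Rel X ℓ} (<-spo : IsStrictPartialOrder _≡_ _<_) where

  open IsStrictPartialOrder <-spo using (irrefl) renaming (trans to <ₓ-trans)

  Lex-trans : ∀ {s t u} → Lex< _<_ s t → Lex< _<_ t u → Lex< _<_ s u
  Lex-trans {s} {t} {u} (k , s≡t , sk<tk) (l , t≡u , tl<ul) with <-cmp k l
  ... | tri< k<l _ _ =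
    k , (λ i i<k → trans (s≡t i i<k) (t≡u i (<-trans i<k k<l))) , subst (s k <_) (t≡u k k<l) sk<tk
  ... | tri≈ _ refl _ = k , (λ i i<k → trans (s≡t i i<k) (t≡u i i<k)) , <ₓ-trans sk<tk tl<ul
  ... | tri> _ _ l<k =
    l , (λ i i<l → trans (s≡t i (<-trans i<l l<k)) (t≡u i i<l)) , subst (_< u l) (sym (s≡t l l<k)) tl<ul

  Lex-respˡ : ∀ {s s′ t} → s ≗ s′ → Lex< _<_ s t → Lex< _<_ s′ t
  Lex-respˡ {t = t} s≗s′ (k , s≡t , sk<tk) =
    k , (λ i i<k → trans (sym (s≗s′ i)) (s≡t i i<k)) , subst (_< t k) (s≗s′ k) sk<tk

  Lex-respʳ : ∀ {s t t′} → t ≗ t′ → Lex< _<_ s t → Lex< _<_ s t′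
  Lex-respʳ {s} t≗t′ (k , s≡t , sk<tk) =
    k , (λ i i<k → trans (s≡t i i<k) (t≗t′ i)) , subst (s k <_) (t≗t′ k) sk<tk

  Lex-irrefl : ∀ {s} → ¬ Lex< _<_ s s
  Lex-irrefl (k , _ , sk<sk) = irrefl refl sk<sk

  -- A partial order containing ⪯ω: comparing roots is replaced by comparing u^ω, so that
  -- antisymmetry does not depend on the uniqueness of primitive roots.
  _⊑_ : Rel (List⁺ X) (a ⊔ ℓ)
  u ⊑ v = (ωstr _<_ u ≗ ωstr _<_ v × length (toList u) ≤ length (toList v))
        ⊎ Lex< _<_ (ωstr _<_ u) (ωstr _<_ v)

  ⪯ω⇒⊑ : ∀ {u v} → _⪯ω_ _<_ u v → u ⊑ v
  ⪯ω⇒⊑ (inj₁ (r , e , f , u-root , v-root , e≤f)) =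
    inj₁ ( (λ i → trans (ωstr-root _<_ r e u-root i) (sym (ωstr-root _<_ r f v-root i)))
         , subst₂ _≤_ (sym (length-root _<_ r e u-root)) (sym (length-root _<_ r f v-root))
                  (*-monoˡ-≤ _ e≤f))
  ⪯ω⇒⊑ (inj₂ (_ , u<v)) = inj₂ u<v

  ⊑-trans : ∀ {u v w} → u ⊑ v → v ⊑ w → u ⊑ w
  ⊑-trans (inj₁ (u≗v , u≤v)) (inj₁ (v≗w , v≤w)) = inj₁ ((λ i → trans (u≗v i) (v≗w i)) , ≤-trans u≤v v≤w)
  ⊑-trans (inj₁ (u≗v , _)) (inj₂ v<w) = inj₂ (Lex-respˡ (sym ∘ u≗v) v<w)
  ⊑-trans (inj₂ u<v) (inj₁ (v≗w , _)) = inj₂ (Lex-respʳ v≗w u<v)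
  ⊑-trans (inj₂ u<v) (inj₂ v<w) = inj₂ (Lex-trans u<v v<w)

  ⊑-antisym : ∀ {u v} → u ⊑ v → v ⊑ u → u ≡ v
  ⊑-antisym {u} {v} (inj₁ (u≗v , u≤v)) (inj₁ (_ , v≤u)) =
    toList-injective (++ω-injectiveˡ (toList u) (toList v) (≤-antisym u≤v v≤u) prefixes)
    where
    prefixes : toList u ++ω ωstr _<_ u ≗ toList v ++ω ωstr _<_ v
    prefixes i = trans (sym (ωstr-unfold _<_ u i)) (trans (u≗v i) (ωstr-unfold _<_ v i))
  ⊑-antisym (inj₁ (u≗v , _)) (inj₂ v<u) = ⊥-elim (Lex-irrefl (Lex-respʳ u≗v v<u))
  ⊑-antisym (inj₂ u<v) (inj₁ (v≗u , _)) = ⊥-elim (Lex-irrefl (Lex-respʳ v≗u u<v))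
  ⊑-antisym (inj₂ u<v) (inj₂ v<u) = ⊥-elim (Lex-irrefl (Lex-trans u<v v<u))

  ⊑-isPartialOrder : IsPartialOrder _≡_ _⊑_
  ⊑-isPartialOrder = record
    { isPreorder = record
      { isEquivalence = isEquivalence
      ; reflexive = λ { refl → inj₁ ((λ _ → refl) , ≤-refl) }
      ; trans = ⊑-trans
      }
    ; antisym = ⊑-antisym
    }

module _ {a ℓ} {X : Set a} {_<_ : Rel X ℓ} (<-asym : Asymmetric _<_) where

  ∈-tail-if-above : ∀ {x z xs ys} → All (x <_) xs → z ∈ xs → z ∈ x ∷ ys → z ∈ ys
  ∈-tail-if-above x<xs z∈xs (here refl) = contradiction (All.lookup x<xs z∈xs) (λ x<x → <-asym x<x x<x)
  ∈-tail-if-above x<xs z∈xs (there z∈ys) = z∈ys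

  head-≡-if-∼set : ∀ {x y xs ys} → All (x <_) xs → All (y <_) ys →
                   x ∷ xs ∼[ set ] y ∷ ys → x ≡ y
  head-≡-if-∼set x<xs y<ys eq with Equivalence.to eq (here refl) | Equivalence.from eq (here refl)
  ... | here x≡y | _ = x≡y
  ... | there _ | here y≡x = sym y≡x
  ... | there x∈ys | there y∈xs = contradiction (All.lookup y<ys x∈ys) (<-asym (All.lookup x<xs y∈xs))

  strict↗∼set↗⇒≡ : ∀ {xs ys} → AllPairs _<_ xs → AllPairs _<_ ys → xs ∼[ set ] ys → xs ≡ ys
  strict↗∼set↗⇒≡ [] [] _ = refl
  strict↗∼set↗⇒≡ [] (_ ∷ _) eq with () ← Equivalence.from eq (here refl)
  strict↗∼set↗⇒≡ (_ ∷ _) [] eq with () ← Equivalence.to eq (here refl)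
  strict↗∼set↗⇒≡ (x<xs ∷ xs↗) (y<ys ∷ ys↗) eq with refl ← head-≡-if-∼set x<xs y<ys eq =
    cong (_ ∷_) (strict↗∼set↗⇒≡ xs↗ ys↗ (mk⇔
      (λ z∈xs → ∈-tail-if-above x<xs z∈xs (Equivalence.to eq (there z∈xs)))
      (λ z∈ys → ∈-tail-if-above y<ys z∈ys (Equivalence.from eq (there z∈ys)))))

module _ {a} {X : Set a} (_≟_ : DecidableEquality X) where

  derun-∷ : ∀ x xs → ∃ λ ys → derun _≟_ (x ∷ xs) ≡ x ∷ ys
  derun-∷ x [] = [] , refl
  derun-∷ x (y ∷ xs) with x ≟ y
  ... | yes refl = derun-∷ x xs
  ... | no _ = derun _≟_ (y ∷ xs) , refl

  derun-∼set : ∀ xs → derun _≟_ xs ∼[ set ] xs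
  derun-∼set xs = mk⇔ (∈-derun⁻ _≟_ xs) (∈-derun⁺ _≟_)

  module _ {ℓ} {_≤_ : Rel X ℓ} (≤-po : IsPartialOrder _≡_ _≤_) where

    open NonStrictToStrict _≡_ _≤_ using () renaming (_<_ to _⊏_; <-trans to ⊏-trans; <-asym to ⊏-asym)
    open IsPartialOrder ≤-po using (antisym)

    derun-↗ : ∀ {xs} → Linked _≤_ xs → Linked _⊏_ (derun _≟_ xs)
    derun-↗ [] = []
    derun-↗ [-] = [-]
    derun-↗ {x ∷ y ∷ xs} (x≤y ∷ y∷xs↗) with x ≟ y
    ... | yes refl = derun-↗ y∷xs↗
    ... | no x≢y with derun _≟_ (y ∷ xs) | derun-∷ y xs | derun-↗ y∷xs↗
    ...   | _ | _ , refl | derun↗ = (x≤y , x≢y) ∷ derun↗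

    ↗∼set↗⇒derun≡ : ∀ {xs ys} → Linked _≤_ xs → Linked _≤_ ys → xs ∼[ set ] ys →
                    derun _≟_ xs ≡ derun _≟_ ys
    ↗∼set↗⇒derun≡ {xs} {ys} xs↗ ys↗ xs∼ys = strict↗∼set↗⇒≡ (⊏-asym antisym)
      (Linked⇒AllPairs (⊏-trans ≤-po) (derun-↗ xs↗))
      (Linked⇒AllPairs (⊏-trans ≤-po) (derun-↗ ys↗))
      (⇔.trans (derun-∼set xs) (⇔.trans xs∼ys (⇔.sym (derun-∼set ys))))

module _ {a c} {X : Set a} {C : Set c} (_≟X_ : DecidableEquality X) (_≟_ : DecidableEquality C) where

  runs-dup : ∀ x xs → runs _≟_ (x ∷ x ∷ xs) ≡ runs _≟_ (x ∷ xs)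
  runs-dup x xs with x ≟ x
  ... | yes _ = refl
  ... | no x≢x = contradiction refl x≢x

  runs-cong-∷ : ∀ x {y ys zs} → runs _≟_ (y ∷ ys) ≡ runs _≟_ (y ∷ zs) →
                runs _≟_ (x ∷ y ∷ ys) ≡ runs _≟_ (x ∷ y ∷ zs)
  runs-cong-∷ x {y} eq with x ≟ y
  ... | yes _ = eq
  ... | no _ = cong suc eq

  runs-map-derun : ∀ (f : X → C) xs → runs _≟_ (map f (derun _≟X_ xs)) ≡ runs _≟_ (map f xs)
  runs-map-derun f [] = refl
  runs-map-derun f (x ∷ []) = refl
  runs-map-derun f (x ∷ y ∷ xs) with runs-map-derun f (y ∷ xs) | x ≟X y
  ... | ih | yes refl = trans ih (sym (runs-dup (f x) (map f xs)))
  ... | ih | no _ with derun _≟X_ (y ∷ xs) | derun-∷ _≟X_ y xs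
  ...   | _ | _ , refl = runs-cong-∷ (f x) ih

allRotations-cong : ∀ {a ℓ} {X : Set a} (_<_ : Rel X ℓ) {W V : List (List⁺ X)} →
                    W ∼[ set ] V → allRotations _<_ W ∼[ set ] allRotations _<_ V
allRotations-cong _<_ W∼V = concat-cong (map-cong (λ _ → refl) W∼V)

corollary1 : ∀ {a ℓ} {Alph : Set a} {_<_ : Rel Alph ℓ}
    (sto : IsStrictTotalOrder _≡_ _<_)
    (A B : List (List⁺ Alph)) →
    Unique B → (∀ x → (x ∈ A) ⇔ (x ∈ B)) →
    ∀ (ebwtA ebwtB : List Alph) →
    IsEbwt _<_ A ebwtA → IsEbwt _<_ B ebwtB →
    runs (IsStrictTotalOrder._≟_ sto) ebwtA ≡ runs (IsStrictTotalOrder._≟_ sto) ebwtB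
corollary1 {_<_ = _<_} sto A B _ A∼B _ _ (LA , LA↭ , LA↗ , refl) (LB , LB↭ , LB↗ , refl) = begin
  runs _≟_ (map last LA)               ≡⟨ runs-map-derun _≟⁺_ _≟_ last LA ⟨
  runs _≟_ (map last (derun _≟⁺_ LA))  ≡⟨ cong (runs _≟_ ∘ map last) derun-LA≡derun-LB ⟩
  runs _≟_ (map last (derun _≟⁺_ LB))  ≡⟨ runs-map-derun _≟⁺_ _≟_ last LB ⟩
  runs _≟_ (map last LB)               ∎
  where
  open ≡-Reasoning
  open IsStrictTotalOrder sto using (_≟_; isStrictPartialOrder)

  _≟⁺_ : DecidableEquality (List⁺ _)
  _≟⁺_ = ≡-dec⁺ _≟_

  ↭⇒∼set : ∀ {xs ys : List (List⁺ _)} → xs ↭ ys → xs ∼[ set ] ys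
  ↭⇒∼set = bag-=⇒ ∘ ↭⇒∼bag

  LA∼LB : LA ∼[ set ] LB
  LA∼LB = ⇔.trans (↭⇒∼set LA↭) (⇔.trans (allRotations-cong _<_ (λ {x} → A∼B x)) (⇔.sym (↭⇒∼set LB↭)))

  derun-LA≡derun-LB : derun _≟⁺_ LA ≡ derun _≟⁺_ LB
  derun-LA≡derun-LB = ↗∼set↗⇒derun≡ _≟⁺_ (⊑-isPartialOrder isStrictPartialOrder)
    (Linked.map (⪯ω⇒⊑ isStrictPartialOrder) LA↗) (Linked.map (⪯ω⇒⊑ isStrictPartialOrder) LB↗) LA∼LB
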